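{- Let $n \ge 1$ be an integer with $n \ne 1, 3$, and let $I_n = \mathbb{Z} \times n\mathbb{Z}$. Then every internal triangle intersects $I_n$ in at most two points.
   Context: A lattice triangle is the convex hull in $\mathbb{R}^2$ of three non-collinear points of $\mathbb{Z}^2$. A triangle is a set $T = \Delta \cap \mathbb{Z}^2$ for a lattice triangle $\Delta$. An internal triangle is a triangle containing exactly $4$ points of $\mathbb{Z}^2$ whose non-vertex point lies in the interior of $\Delta$. -}

module Defs where

open import Data.Nat using (ℕ; suc)
open import Data.Integer using (ℤ; +_; _+_; _-_; _*_)
open import Data.Integer.Divisibility using (_∣_)
open import Data.Product using (_×_; _,_; Σ; ∃; proj₁; proj₂)
open import Data.Sum using (_⊎_)
open import Relation.Binary.PropositionalEquality using (_≡_)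
open import Relation.Nullary using (¬_)

Point : Set
Point = ℤ × ℤ

xc yc : Point → ℤ
xc = proj₁
yc = proj₂

-- Twice the signed area of (a,b,c); a,b,c are collinear iff it is 0.
cross : Point → Point → Point → ℤ
cross a b c = (xc b - xc a) * (yc c - yc a) - (yc b - yc a) * (xc c - xc a)

NonCollinear : Point → Point → Point → Set
NonCollinear a b c = ¬ (cross a b c ≡ + 0)

-- p = (l a + m b + k c) / (l + m + k) with l, m, k ≥ 0, l + m + k > 0.
-- (Barycentric coordinates of a lattice point w.r.t. a lattice triangle are
--  rational, so this is exactly membership of p in the convex hull.)
IsConvComb : Point → Point → Point → Point → ℕ → ℕ → ℕ → Set
IsConvComb a b c p l m k =
  (+ (l Data.Nat.+ m Data.Nat.+ k)) * xc p ≡ (+ l) * xc a + (+ m) * xc b + (+ k) * xc c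
  × (+ (l Data.Nat.+ m Data.Nat.+ k)) * yc p ≡ (+ l) * yc a + (+ m) * yc b + (+ k) * yc c

InHull : Point → Point → Point → Point → Set
InHull a b c p = Σ ℕ λ l → Σ ℕ λ m → Σ ℕ λ k →
  (¬ (l Data.Nat.+ m Data.Nat.+ k ≡ 0)) × IsConvComb a b c p l m k

InInterior : Point → Point → Point → Point → Set
InInterior a b c p = Σ ℕ λ l → Σ ℕ λ m → Σ ℕ λ k →
  IsConvComb a b c p (suc l) (suc m) (suc k)

InternalTriangle : Point → Point → Point → Set
InternalTriangle a b c =
  NonCollinear a b c ×
  ∃ λ q → InInterior a b c q ×
    (∀ p → InHull a b c p → p ≡ a ⊎ p ≡ b ⊎ p ≡ c ⊎ p ≡ q)

InI : ℕ → Point → Set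
InI n p = (+ n) ∣ yc p

{-# OPTIONS --safe #-}
-- Since the only lattice points of an internal triangle abc with interior point q are a, b, c, q, the
-- subtriangles abq, bcq, caq have no lattice points besides their vertices. An empty lattice triangle
-- xyz is unimodular: if D = cross x y z exceeded 1, reducing x + e₁ or x + e₂ modulo the lattice
-- spanned by y − x and z − x (and reflecting through the midpoint of yz when the residue lies beyond
-- the edge yz) gives a lattice point of xyz other than its vertices, unless both unit vectors lie in
-- that lattice, which would force D² ∣ D. Hence cross a b q, cross b c q, cross c a q are ±1 and
-- cross a b c, their sum, is ±1 or ±3. If three of a, b, c, q lay in I_n = ℤ × nℤ, then n would
-- divide their cross product and hence 3.
module Submission where

open import Data.Bool using (true; false; if_then_else_)
open import Data.Empty using (⊥-elim)
open import Data.Integer as ℤ using (ℤ; +_; -[1+_]; _+_; _-_; _*_; -_; ∣_∣; 0ℤ; 1ℤ; -1ℤ)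
open import Data.Integer.DivMod using (_%ℕ_; _/ℕ_; a≡a%ℕn+[a/ℕn]*n; n%ℕd<d)
import Data.Integer.Divisibility.Signed as Signed
open import Data.Integer.Properties using (pos-*)
import Data.Integer.Properties as ℤP
open import Data.Integer.Tactic.RingSolver using (solve-∀)
open import Data.List using (List; []; _∷_; length; filter; _++_; map)
open import Data.List.Membership.Propositional using (_∈_)
open import Data.List.Membership.Propositional.Properties using (∈-∃++; ∈-++⁻; ∈-++⁺ˡ; ∈-++⁺ʳ; ∈-filter⁺)
open import Data.List.Properties using (length-++)
open import Data.List.Relation.Binary.Subset.Propositional using (_⊆_)
open import Data.List.Relation.Unary.All as All using (All)
open import Data.List.Relation.Unary.AllPairs using (_∷_)
open import Data.List.Relation.Unary.Any using (here; there)
open import Data.List.Relation.Unary.Unique.Propositional using (Unique)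
open import Data.Nat as ℕ using (ℕ; zero; suc; z≤n; s≤s)
import Data.Nat.Divisibility as ℕ∣
open import Data.Nat.ListAction using (sum)
open import Data.Nat.Primality using (prime?; prime⇒irreducible)
import Data.Nat.Properties as ℕP
import Data.Nat.Tactic.RingSolver as ℕSolver
open import Data.Product using (_×_; _,_; Σ)
import Data.Product as Product
open import Data.Sum using (_⊎_; inj₁; inj₂; [_,_]; map₂)
import Data.Sum as Sum
open import Function using (_∘_; id)
open import Relation.Binary.PropositionalEquality
  using (_≡_; _≢_; refl; sym; trans; cong; cong₂; subst; module ≡-Reasoning)
open import Relation.Nullary using (¬_; yes; no; does; contradiction)
open import Relation.Nullary.Decidable using (toWitness)
open import Relation.Unary using (Decidable)

open import Defs

∣-*-∣ : ∀ {a b c d} → a Signed.∣ b → c Signed.∣ d → a * c Signed.∣ b * d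
∣-*-∣ {_} {b} {c} a∣b c∣d = Signed.∣-trans (Signed.*-monoˡ-∣ c a∣b) (Signed.*-monoʳ-∣ b c∣d)

reflected-residues : ∀ {D s t} → s ℕ.< D → t ℕ.< D → D ℕ.< s ℕ.+ t →
  D ℕ.∸ s ℕ.< D × D ℕ.∸ t ℕ.< D ×
  0 ℕ.< (D ℕ.∸ s) ℕ.+ (D ℕ.∸ t) × (D ℕ.∸ s) ℕ.+ (D ℕ.∸ t) ℕ.≤ D
reflected-residues {D} {s} {t} s<D t<D D<s+t =
    ℕP.∸-monoʳ-< 0<s (ℕP.<⇒≤ s<D)
  , ℕP.∸-monoʳ-< 0<t (ℕP.<⇒≤ t<D)
  , ℕP.<-≤-trans (ℕP.m<n⇒0<n∸m s<D) (ℕP.m≤m+n _ _)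
  , (begin
      (D ℕ.∸ s) ℕ.+ (D ℕ.∸ t) ≤⟨ ℕP.+-monoˡ-≤ (D ℕ.∸ t) (ℕP.<⇒≤ D∸s<t) ⟩
      t ℕ.+ (D ℕ.∸ t)         ≡⟨ ℕP.m+[n∸m]≡n (ℕP.<⇒≤ t<D) ⟩
      D                       ∎)
  where
  open ℕP.≤-Reasoning
  D∸s<t : D ℕ.∸ s ℕ.< t
  D∸s<t = subst (D ℕ.∸ s ℕ.<_) (ℕP.m+n∸m≡n s t) (ℕP.∸-monoˡ-< D<s+t (ℕP.<⇒≤ s<D))
  D∸t<s : D ℕ.∸ t ℕ.< s
  D∸t<s = subst (D ℕ.∸ t ℕ.<_) (ℕP.m+n∸n≡m s t) (ℕP.∸-monoˡ-< D<s+t (ℕP.<⇒≤ t<D))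
  0<s : 0 ℕ.< s
  0<s = ℕP.≤-<-trans z≤n D∸t<s
  0<t : 0 ℕ.< t
  0<t = ℕP.≤-<-trans z≤n D∸s<t

module _ {A : Set} where

  Unique-⊆⇒length≤ : ∀ {xs ys : List A} → Unique xs → xs ⊆ ys → length xs ℕ.≤ length ys
  Unique-⊆⇒length≤ {[]} _ _ = z≤n
  Unique-⊆⇒length≤ {x ∷ xs} (x∉xs ∷ unique) xs⊆ys with ∈-∃++ (xs⊆ys (here refl))
  ... | us , vs , refl = begin
    suc (length xs)                ≤⟨ s≤s (Unique-⊆⇒length≤ unique xs⊆us++vs) ⟩
    suc (length (us ++ vs))        ≡⟨ cong suc (length-++ us) ⟩
    suc (length us ℕ.+ length vs)  ≡⟨ ℕP.+-suc (length us) (length vs) ⟨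
    length us ℕ.+ length (x ∷ vs)  ≡⟨ length-++ us ⟨
    length (us ++ x ∷ vs)          ∎
    where
    open ℕP.≤-Reasoning
    xs⊆us++vs : xs ⊆ us ++ vs
    xs⊆us++vs {y} y∈xs with ∈-++⁻ us (xs⊆ys (there y∈xs))
    ... | inj₁ y∈us         = ∈-++⁺ˡ y∈us
    ... | inj₂ (here y≡x)   = contradiction (sym y≡x) (All.lookup x∉xs y∈xs)
    ... | inj₂ (there y∈vs) = ∈-++⁺ʳ us y∈vs

  module _ {P : A → Set} (P? : Decidable P) where

    -- Counting through indicators makes all four decisions visible to one `with`;
    -- filter only exposes the decision on its head.
    indicator : A → ℕ
    indicator x = if does (P? x) then 1 else 0

    length-filter≡sum-indicator : ∀ xs → length (filter P? xs) ≡ sum (map indicator xs)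
    length-filter≡sum-indicator []       = refl
    length-filter≡sum-indicator (x ∷ xs) with does (P? x)
    ... | true  = cong suc (length-filter≡sum-indicator xs)
    ... | false = length-filter≡sum-indicator xs

    length-filter≤2 : ∀ {a b c d} →
      ¬ (P a × P b × P c) × ¬ (P a × P b × P d) × ¬ (P b × P c × P d) × ¬ (P c × P a × P d) →
      length (filter P? (a ∷ b ∷ c ∷ d ∷ [])) ℕ.≤ 2
    length-filter≤2 {a} {b} {c} {d} (abc , abd , bcd , cad) =
      subst (ℕ._≤ 2) (sym (length-filter≡sum-indicator (a ∷ b ∷ c ∷ d ∷ []))) table
      where
      table : sum (map indicator (a ∷ b ∷ c ∷ d ∷ [])) ℕ.≤ 2
      table with P? a | P? b | P? c | P? d
      ... | yes pa | yes pb | yes pc | _      = contradiction (pa , pb , pc) abc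
      ... | yes pa | yes pb | no _   | yes pd = contradiction (pa , pb , pd) abd
      ... | yes _  | yes _  | no _   | no _   = ℕP.≤-refl
      ... | yes pa | no _   | yes pc | yes pd = contradiction (pc , pa , pd) cad
      ... | yes _  | no _   | yes _  | no _   = ℕP.≤-refl
      ... | yes _  | no _   | no _   | yes _  = ℕP.≤-refl
      ... | yes _  | no _   | no _   | no _   = s≤s z≤n
      ... | no _   | yes pb | yes pc | yes pd = contradiction (pb , pc , pd) bcd
      ... | no _   | yes _  | yes _  | no _   = ℕP.≤-refl
      ... | no _   | yes _  | no _   | yes _  = ℕP.≤-refl
      ... | no _   | yes _  | no _   | no _   = s≤s z≤n
      ... | no _   | no _   | yes _  | yes _  = ℕP.≤-refl
      ... | no _   | no _   | yes _  | no _   = s≤s z≤n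
      ... | no _   | no _   | no _   | yes _  = s≤s z≤n
      ... | no _   | no _   | no _   | no _   = z≤n

cross-rotate : ∀ a b c → cross a b c ≡ cross b c a
cross-rotate (a₁ , a₂) (b₁ , b₂) (c₁ , c₂) = rotate a₁ a₂ b₁ b₂ c₁ c₂
  where
  rotate : ∀ a₁ a₂ b₁ b₂ c₁ c₂ →
    (b₁ - a₁) * (c₂ - a₂) - (b₂ - a₂) * (c₁ - a₁) ≡ (c₁ - b₁) * (a₂ - b₂) - (c₂ - b₂) * (a₁ - b₁)
  rotate = solve-∀

cross-swap : ∀ a b c → cross a c b ≡ - cross a b c
cross-swap (a₁ , a₂) (b₁ , b₂) (c₁ , c₂) = swap a₁ a₂ b₁ b₂ c₁ c₂
  where
  swap : ∀ a₁ a₂ b₁ b₂ c₁ c₂ →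
    (c₁ - a₁) * (b₂ - a₂) - (c₂ - a₂) * (b₁ - a₁) ≡ - ((b₁ - a₁) * (c₂ - a₂) - (b₂ - a₂) * (c₁ - a₁))
  swap = solve-∀

cross-split : ∀ a b c q → cross a b c ≡ cross a b q + cross b c q + cross c a q
cross-split (a₁ , a₂) (b₁ , b₂) (c₁ , c₂) (q₁ , q₂) = split a₁ a₂ b₁ b₂ c₁ c₂ q₁ q₂
  where
  split : ∀ a₁ a₂ b₁ b₂ c₁ c₂ q₁ q₂ → (b₁ - a₁) * (c₂ - a₂) - (b₂ - a₂) * (c₁ - a₁) ≡
    ((b₁ - a₁) * (q₂ - a₂) - (b₂ - a₂) * (q₁ - a₁)) + ((c₁ - b₁) * (q₂ - b₂) - (c₂ - b₂) * (q₁ - b₁))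
      + ((a₁ - c₁) * (q₂ - c₂) - (a₂ - c₂) * (q₁ - c₁))
  split = solve-∀

-- One coordinate of IsConvComb with integer weights: IsConvComb a b c p l m k is definitionally
-- ConvCombCoord (+ l) (+ m) (+ k) on both coordinates, as + (l + m + k) reduces to + l + + m + + k.
ConvCombCoord : ℤ → ℤ → ℤ → ℤ → ℤ → ℤ → ℤ → Set
ConvCombCoord l m k a b c p = (l + m + k) * p ≡ l * a + m * b + k * c

module _ (l m k a b c p : ℤ) where
  open ≡-Reasoning

  ConvCombCoord-rotate : ConvCombCoord l m k a b c p → ConvCombCoord m k l b c a p
  ConvCombCoord-rotate h = begin
    (m + k + l) * p        ≡⟨ cong (_* p) (rotate l m k) ⟨
    (l + m + k) * p        ≡⟨ h ⟩
    l * a + m * b + k * c  ≡⟨ rotate (l * a) (m * b) (k * c) ⟩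
    m * b + k * c + l * a  ∎
    where rotate : ∀ u v w → u + v + w ≡ v + w + u
          rotate = solve-∀

  ConvCombCoord-swap : ConvCombCoord l m k a b c p → ConvCombCoord l k m a c b p
  ConvCombCoord-swap h = begin
    (l + k + m) * p        ≡⟨ cong (_* p) (swap l m k) ⟨
    (l + m + k) * p        ≡⟨ h ⟩
    l * a + m * b + k * c  ≡⟨ swap (l * a) (m * b) (k * c) ⟩
    l * a + k * c + m * b  ∎
    where swap : ∀ u v w → u + v + w ≡ u + w + v
          swap = solve-∀

composed-weights-sum : ∀ x y z L M K → let S = L ℕ.+ M ℕ.+ K in
  x ℕ.* S ℕ.+ z ℕ.* L ℕ.+ (y ℕ.* S ℕ.+ z ℕ.* M) ℕ.+ z ℕ.* K ≡ (x ℕ.+ y ℕ.+ z) ℕ.* S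
composed-weights-sum = ℕSolver.solve-∀

ConvCombCoord-compose : ∀ (x y z L M K : ℕ) (a b c q p : ℤ) → let S = L ℕ.+ M ℕ.+ K in
  ConvCombCoord (+ x) (+ y) (+ z) a b q p → ConvCombCoord (+ L) (+ M) (+ K) a b c q →
  ConvCombCoord (+ (x ℕ.* S ℕ.+ z ℕ.* L)) (+ (y ℕ.* S ℕ.+ z ℕ.* M)) (+ (z ℕ.* K)) a b c p
ConvCombCoord-compose x y z L M K a b c q p hp hq = begin
  + (x ℕ.* S ℕ.+ z ℕ.* L ℕ.+ (y ℕ.* S ℕ.+ z ℕ.* M) ℕ.+ z ℕ.* K) * p
    ≡⟨ cong (λ w → + w * p) (composed-weights-sum x y z L M K) ⟩
  + ((x ℕ.+ y ℕ.+ z) ℕ.* S) * p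
    ≡⟨ cong (_* p) (pos-* (x ℕ.+ y ℕ.+ z) S) ⟩
  + (x ℕ.+ y ℕ.+ z) * + S * p
    ≡⟨ *-comm-assoc (+ (x ℕ.+ y ℕ.+ z)) (+ S) p ⟩
  + S * (+ (x ℕ.+ y ℕ.+ z) * p)
    ≡⟨ cong (+ S *_) hp ⟩
  + S * (+ x * a + + y * b + + z * q)
    ≡⟨ distribute (+ S) (+ x) (+ y) (+ z) a b q ⟩
  + x * + S * a + + y * + S * b + + z * (+ S * q)
    ≡⟨ cong (λ u → + x * + S * a + + y * + S * b + + z * u) hq ⟩
  + x * + S * a + + y * + S * b + + z * (+ L * a + + M * b + + K * c)
    ≡⟨ collect (+ x) (+ y) (+ z) (+ L) (+ M) (+ K) a b c ⟩
  (+ x * + S + + z * + L) * a + (+ y * + S + + z * + M) * b + + z * + K * c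
    ≡⟨ cong₂ _+_ (cong₂ _+_ (cast x S z L a) (cast y S z M b)) (cong (_* c) (pos-* z K)) ⟨
  + (x ℕ.* S ℕ.+ z ℕ.* L) * a + + (y ℕ.* S ℕ.+ z ℕ.* M) * b + + (z ℕ.* K) * c ∎
  where
  open ≡-Reasoning
  S : ℕ
  S = L ℕ.+ M ℕ.+ K
  *-comm-assoc : ∀ T S p → T * S * p ≡ S * (T * p)
  *-comm-assoc = solve-∀
  distribute : ∀ S X Y Z a b q → S * (X * a + Y * b + Z * q) ≡ X * S * a + Y * S * b + Z * (S * q)
  distribute = solve-∀
  collect : ∀ X Y Z L M K a b c → let S = L + M + K in
    X * S * a + Y * S * b + Z * (L * a + M * b + K * c) ≡ (X * S + Z * L) * a + (Y * S + Z * M) * b + Z * K * c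
  collect = solve-∀
  cast : ∀ x S z L a → + (x ℕ.* S ℕ.+ z ℕ.* L) * a ≡ (+ x * + S + + z * + L) * a
  cast x S z L a = cong (_* a) (cong₂ _+_ (pos-* x S) (pos-* z L))

IsConvComb-rotate : ∀ a b c p l m k → IsConvComb a b c p l m k → IsConvComb b c a p m k l
IsConvComb-rotate (a₁ , a₂) (b₁ , b₂) (c₁ , c₂) (p₁ , p₂) l m k =
  Product.map (ConvCombCoord-rotate (+ l) (+ m) (+ k) a₁ b₁ c₁ p₁)
              (ConvCombCoord-rotate (+ l) (+ m) (+ k) a₂ b₂ c₂ p₂)

IsConvComb-swap : ∀ a b c p l m k → IsConvComb a b c p l m k → IsConvComb a c b p l k m
IsConvComb-swap (a₁ , a₂) (b₁ , b₂) (c₁ , c₂) (p₁ , p₂) l m k =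
  Product.map (ConvCombCoord-swap (+ l) (+ m) (+ k) a₁ b₁ c₁ p₁)
              (ConvCombCoord-swap (+ l) (+ m) (+ k) a₂ b₂ c₂ p₂)

IsConvComb-compose : ∀ a b c q p x y z L M K → IsConvComb a b q p x y z → IsConvComb a b c q L M K →
  let S = L ℕ.+ M ℕ.+ K in IsConvComb a b c p (x ℕ.* S ℕ.+ z ℕ.* L) (y ℕ.* S ℕ.+ z ℕ.* M) (z ℕ.* K)
IsConvComb-compose (a₁ , a₂) (b₁ , b₂) (c₁ , c₂) (q₁ , q₂) (p₁ , p₂) x y z L M K (hp₁ , hp₂) (hq₁ , hq₂) =
  ConvCombCoord-compose x y z L M K a₁ b₁ c₁ q₁ p₁ hp₁ hq₁ ,
  ConvCombCoord-compose x y z L M K a₂ b₂ c₂ q₂ p₂ hp₂ hq₂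

IsConvComb⇒cross : ∀ a b q p x y z → IsConvComb a b q p x y z → + (x ℕ.+ y ℕ.+ z) * cross a b p ≡ + z * cross a b q
IsConvComb⇒cross (a₁ , a₂) (b₁ , b₂) (q₁ , q₂) (p₁ , p₂) x y z (h₁ , h₂) = begin
  T * ((b₁ - a₁) * (p₂ - a₂) - (b₂ - a₂) * (p₁ - a₁))
    ≡⟨ expand T a₁ a₂ b₁ b₂ p₁ p₂ ⟩
  (b₁ - a₁) * (T * p₂) - (b₂ - a₂) * (T * p₁) - T * ((b₁ - a₁) * a₂ - (b₂ - a₂) * a₁)
    ≡⟨ cong₂ (λ u v → (b₁ - a₁) * u - (b₂ - a₂) * v - T * ((b₁ - a₁) * a₂ - (b₂ - a₂) * a₁)) h₂ h₁ ⟩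
  (b₁ - a₁) * (+ x * a₂ + + y * b₂ + + z * q₂) - (b₂ - a₂) * (+ x * a₁ + + y * b₁ + + z * q₁)
    - T * ((b₁ - a₁) * a₂ - (b₂ - a₂) * a₁)
    ≡⟨ collapse (+ x) (+ y) (+ z) a₁ a₂ b₁ b₂ q₁ q₂ ⟩
  + z * ((b₁ - a₁) * (q₂ - a₂) - (b₂ - a₂) * (q₁ - a₁)) ∎
  where
  open ≡-Reasoning
  T : ℤ
  T = + (x ℕ.+ y ℕ.+ z)
  expand : ∀ T a₁ a₂ b₁ b₂ p₁ p₂ → T * ((b₁ - a₁) * (p₂ - a₂) - (b₂ - a₂) * (p₁ - a₁)) ≡
    (b₁ - a₁) * (T * p₂) - (b₂ - a₂) * (T * p₁) - T * ((b₁ - a₁) * a₂ - (b₂ - a₂) * a₁)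
  expand = solve-∀
  collapse : ∀ X Y Z a₁ a₂ b₁ b₂ q₁ q₂ →
    (b₁ - a₁) * (X * a₂ + Y * b₂ + Z * q₂) - (b₂ - a₂) * (X * a₁ + Y * b₁ + Z * q₁)
      - (X + Y + Z) * ((b₁ - a₁) * a₂ - (b₂ - a₂) * a₁)
    ≡ Z * ((b₁ - a₁) * (q₂ - a₂) - (b₂ - a₂) * (q₁ - a₁))
  collapse = solve-∀

InHull-rotate : ∀ a b c p → InHull a b c p → InHull b c a p
InHull-rotate a b c p (l , m , k , l+m+k≢0 , h) =
  m , k , l , l+m+k≢0 ∘ trans (rotate l m k) , IsConvComb-rotate a b c p l m k h
  where rotate : ∀ l m k → l ℕ.+ m ℕ.+ k ≡ m ℕ.+ k ℕ.+ l
        rotate = ℕSolver.solve-∀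

InHull-swap : ∀ a b c p → InHull a b c p → InHull a c b p
InHull-swap a b c p (l , m , k , l+m+k≢0 , h) =
  l , k , m , l+m+k≢0 ∘ trans (exchange l m k) , IsConvComb-swap a b c p l m k h
  where exchange : ∀ l m k → l ℕ.+ m ℕ.+ k ≡ l ℕ.+ k ℕ.+ m
        exchange = ℕSolver.solve-∀

-- Empty lattice triangles are unimodular

NonVertexPoint : Point → Point → Point → Set
NonVertexPoint x y z = Σ Point λ p → InHull x y z p × p ≢ x × p ≢ y × p ≢ z

Empty : Point → Point → Point → Set
Empty x y z = ∀ p → InHull x y z p → p ≡ x ⊎ p ≡ y ⊎ p ≡ z

Empty⇒¬NonVertexPoint : ∀ {x y z} → Empty x y z → ¬ NonVertexPoint x y z
Empty⇒¬NonVertexPoint empty (p , hull , p≢x , p≢y , p≢z) = [ p≢x , [ p≢y , p≢z ] ] (empty p hull)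

Empty-swap : ∀ x y z → Empty x y z → Empty x z y
Empty-swap x y z empty p hull = map₂ Sum.swap (empty p (InHull-swap x z y p hull))

module NonUnimodular (x y z : Point) (D : ℕ) .{{_ : ℕ.NonZero D}} (cross≡D : cross x y z ≡ + D) where

  -- D times the barycentric coordinates of p at y and at z.
  σ τ : Point → ℤ
  σ p = cross x p z
  τ p = cross x y p

  private
    x₁ x₂ y₁ y₂ z₁ z₂ : ℤ
    x₁ = xc x
    x₂ = yc x
    y₁ = xc y
    y₂ = yc y
    z₁ = xc z
    z₂ = yc z

  IsConvComb-of-coordinates : ∀ p l m k → l ℕ.+ m ℕ.+ k ≡ D → σ p ≡ + m → τ p ≡ + k → IsConvComb x y z p l m k
  IsConvComb-of-coordinates (p₁ , p₂) l m k l+m+k≡D σp≡m τp≡k =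
      coordinate x₁ y₁ z₁ p₁ (barycentric₁ x₁ x₂ y₁ y₂ z₁ z₂ p₁ p₂)
    , coordinate x₂ y₂ z₂ p₂ (barycentric₂ x₁ x₂ y₁ y₂ z₁ z₂ p₁ p₂)
    where
    open ≡-Reasoning
    p : Point
    p = (p₁ , p₂)
    +l≡ : + l ≡ cross x y z - σ p - τ p
    +l≡ = begin
      + l                          ≡⟨ cancel (+ l) (+ m) (+ k) ⟩
      + l + + m + + k - + m - + k  ≡⟨ cong (λ n → + n - + m - + k) l+m+k≡D ⟩
      + D - + m - + k              ≡⟨ cong₂ _-_ (cong₂ _-_ cross≡D σp≡m) τp≡k ⟨
      cross x y z - σ p - τ p      ∎
      where cancel : ∀ u v w → u ≡ u + v + w - v - w
            cancel = solve-∀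
    coordinate : ∀ u v w r → cross x y z * r ≡ (cross x y z - σ p - τ p) * u + σ p * v + τ p * w →
                 ConvCombCoord (+ l) (+ m) (+ k) u v w r
    coordinate u v w r eq = begin
      + (l ℕ.+ m ℕ.+ k) * r                               ≡⟨ cong (λ n → + n * r) l+m+k≡D ⟩
      + D * r                                             ≡⟨ cong (_* r) cross≡D ⟨
      cross x y z * r                                     ≡⟨ eq ⟩
      (cross x y z - σ p - τ p) * u + σ p * v + τ p * w   ≡⟨ cong (λ c → c * u + σ p * v + τ p * w) +l≡ ⟨
      + l * u + σ p * v + τ p * w                         ≡⟨ cong₂ (λ c d → + l * u + c * v + d * w) σp≡m τp≡k ⟩
      + l * u + + m * v + + k * w                         ∎
    barycentric₁ : ∀ x₁ x₂ y₁ y₂ z₁ z₂ p₁ p₂ →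
      let D = (y₁ - x₁) * (z₂ - x₂) - (y₂ - x₂) * (z₁ - x₁)
          s = (p₁ - x₁) * (z₂ - x₂) - (p₂ - x₂) * (z₁ - x₁)
          t = (y₁ - x₁) * (p₂ - x₂) - (y₂ - x₂) * (p₁ - x₁)
      in D * p₁ ≡ (D - s - t) * x₁ + s * y₁ + t * z₁
    barycentric₁ = solve-∀
    barycentric₂ : ∀ x₁ x₂ y₁ y₂ z₁ z₂ p₁ p₂ →
      let D = (y₁ - x₁) * (z₂ - x₂) - (y₂ - x₂) * (z₁ - x₁)
          s = (p₁ - x₁) * (z₂ - x₂) - (p₂ - x₂) * (z₁ - x₁)
          t = (y₁ - x₁) * (p₂ - x₂) - (y₂ - x₂) * (p₁ - x₁)
      in D * p₂ ≡ (D - s - t) * x₂ + s * y₂ + t * z₂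
    barycentric₂ = solve-∀

  σ[x]≡0 : σ x ≡ 0ℤ
  σ[x]≡0 = vanish x₁ x₂ z₁ z₂
    where vanish : ∀ x₁ x₂ z₁ z₂ → (x₁ - x₁) * (z₂ - x₂) - (x₂ - x₂) * (z₁ - x₁) ≡ 0ℤ
          vanish = solve-∀

  τ[x]≡0 : τ x ≡ 0ℤ
  τ[x]≡0 = vanish x₁ x₂ y₁ y₂
    where vanish : ∀ x₁ x₂ y₁ y₂ → (y₁ - x₁) * (x₂ - x₂) - (y₂ - x₂) * (x₁ - x₁) ≡ 0ℤ
          vanish = solve-∀

  nonvertex-of-weights : ∀ p l m k → l ℕ.+ m ℕ.+ k ≡ D → l ℕ.< D → m ℕ.< D → k ℕ.< D →
    σ p ≡ + m → τ p ≡ + k → NonVertexPoint x y z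
  nonvertex-of-weights p l m k l+m+k≡D l<D m<D k<D σp≡m τp≡k =
    p , (l , m , k , l+m+k≢0 , IsConvComb-of-coordinates p l m k l+m+k≡D σp≡m τp≡k) , p≢x , p≢y , p≢z
    where
    l+m+k≢0 : l ℕ.+ m ℕ.+ k ≢ 0
    l+m+k≢0 = ℕ.≢-nonZero⁻¹ D ∘ trans (sym l+m+k≡D)
    p≢x : p ≢ x
    p≢x p≡x = ℕP.<-irrefl l≡D l<D
      where
      m≡0 : m ≡ 0
      m≡0 = ℤP.+-injective (trans (sym (subst (λ q → σ q ≡ + m) p≡x σp≡m)) σ[x]≡0)
      k≡0 : k ≡ 0
      k≡0 = ℤP.+-injective (trans (sym (subst (λ q → τ q ≡ + k) p≡x τp≡k)) τ[x]≡0)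
      l≡D : l ≡ D
      l≡D = trans (sym (trans (cong₂ (λ a b → l ℕ.+ a ℕ.+ b) m≡0 k≡0)
                              (trans (ℕP.+-identityʳ (l ℕ.+ 0)) (ℕP.+-identityʳ l))))
                  l+m+k≡D
    p≢y : p ≢ y
    p≢y p≡y = ℕP.<-irrefl (ℤP.+-injective (trans (sym (subst (λ q → σ q ≡ + m) p≡y σp≡m)) cross≡D)) m<D
    p≢z : p ≢ z
    p≢z p≡z = ℕP.<-irrefl (ℤP.+-injective (trans (sym (subst (λ q → τ q ≡ + k) p≡z τp≡k)) cross≡D)) k<D

  translate : ℤ → ℤ → Point → Point
  translate α β (p₁ , p₂) = (p₁ - α * (y₁ - x₁) - β * (z₁ - x₁) , p₂ - α * (y₂ - x₂) - β * (z₂ - x₂))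

  σ-translate : ∀ α β p → σ (translate α β p) ≡ σ p - α * cross x y z
  σ-translate α β (p₁ , p₂) = shift x₁ x₂ y₁ y₂ z₁ z₂ p₁ p₂ α β
    where
    shift : ∀ x₁ x₂ y₁ y₂ z₁ z₂ p₁ p₂ α β →
      let p₁′ = p₁ - α * (y₁ - x₁) - β * (z₁ - x₁)
          p₂′ = p₂ - α * (y₂ - x₂) - β * (z₂ - x₂)
      in (p₁′ - x₁) * (z₂ - x₂) - (p₂′ - x₂) * (z₁ - x₁)
         ≡ ((p₁ - x₁) * (z₂ - x₂) - (p₂ - x₂) * (z₁ - x₁)) - α * ((y₁ - x₁) * (z₂ - x₂) - (y₂ - x₂) * (z₁ - x₁))
    shift = solve-∀

  τ-translate : ∀ α β p → τ (translate α β p) ≡ τ p - β * cross x y z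
  τ-translate α β (p₁ , p₂) = shift x₁ x₂ y₁ y₂ z₁ z₂ p₁ p₂ α β
    where
    shift : ∀ x₁ x₂ y₁ y₂ z₁ z₂ p₁ p₂ α β →
      let p₁′ = p₁ - α * (y₁ - x₁) - β * (z₁ - x₁)
          p₂′ = p₂ - α * (y₂ - x₂) - β * (z₂ - x₂)
      in (y₁ - x₁) * (p₂′ - x₂) - (y₂ - x₂) * (p₁′ - x₁)
         ≡ ((y₁ - x₁) * (p₂ - x₂) - (y₂ - x₂) * (p₁ - x₁)) - β * ((y₁ - x₁) * (z₂ - x₂) - (y₂ - x₂) * (z₁ - x₁))
    shift = solve-∀

  reflect : Point → Point
  reflect (p₁ , p₂) = (y₁ + z₁ - p₁ , y₂ + z₂ - p₂)

  σ-reflect : ∀ p → σ (reflect p) ≡ cross x y z - σ p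
  σ-reflect (p₁ , p₂) = mirror x₁ x₂ y₁ y₂ z₁ z₂ p₁ p₂
    where
    mirror : ∀ x₁ x₂ y₁ y₂ z₁ z₂ p₁ p₂ →
      ((y₁ + z₁ - p₁) - x₁) * (z₂ - x₂) - ((y₂ + z₂ - p₂) - x₂) * (z₁ - x₁)
      ≡ ((y₁ - x₁) * (z₂ - x₂) - (y₂ - x₂) * (z₁ - x₁)) - ((p₁ - x₁) * (z₂ - x₂) - (p₂ - x₂) * (z₁ - x₁))
    mirror = solve-∀

  τ-reflect : ∀ p → τ (reflect p) ≡ cross x y z - τ p
  τ-reflect (p₁ , p₂) = mirror x₁ x₂ y₁ y₂ z₁ z₂ p₁ p₂
    where
    mirror : ∀ x₁ x₂ y₁ y₂ z₁ z₂ p₁ p₂ →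
      (y₁ - x₁) * ((y₂ + z₂ - p₂) - x₂) - (y₂ - x₂) * ((y₁ + z₁ - p₁) - x₁)
      ≡ ((y₁ - x₁) * (z₂ - x₂) - (y₂ - x₂) * (z₁ - x₁)) - ((y₁ - x₁) * (p₂ - x₂) - (y₂ - x₂) * (p₁ - x₁))
    mirror = solve-∀

  e₁ e₂ : Point
  e₁ = (x₁ + 1ℤ , x₂)
  e₂ = (x₁ , x₂ + 1ℤ)

  cross-unit-determinant : cross x y z ≡ σ e₁ * τ e₂ - σ e₂ * τ e₁
  cross-unit-determinant = determinant x₁ x₂ y₁ y₂ z₁ z₂
    where
    determinant : ∀ x₁ x₂ y₁ y₂ z₁ z₂ →
      let σ₁ = ((x₁ + 1ℤ) - x₁) * (z₂ - x₂) - (x₂ - x₂) * (z₁ - x₁)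
          τ₁ = (y₁ - x₁) * (x₂ - x₂) - (y₂ - x₂) * ((x₁ + 1ℤ) - x₁)
          σ₂ = (x₁ - x₁) * (z₂ - x₂) - ((x₂ + 1ℤ) - x₂) * (z₁ - x₁)
          τ₂ = (y₁ - x₁) * ((x₂ + 1ℤ) - x₂) - (y₂ - x₂) * (x₁ - x₁)
      in (y₁ - x₁) * (z₂ - x₂) - (y₂ - x₂) * (z₁ - x₁) ≡ σ₁ * τ₂ - σ₂ * τ₁
    determinant = solve-∀

  minus-quotient : ∀ a → a - (a /ℕ D) * cross x y z ≡ + (a %ℕ D)
  minus-quotient a = begin
    a - (a /ℕ D) * cross x y z                     ≡⟨ cong (λ c → a - (a /ℕ D) * c) cross≡D ⟩
    a - (a /ℕ D) * + D                             ≡⟨ cong (_- (a /ℕ D) * + D) (a≡a%ℕn+[a/ℕn]*n a D) ⟩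
    + (a %ℕ D) + (a /ℕ D) * + D - (a /ℕ D) * + D   ≡⟨ cancel (+ (a %ℕ D)) ((a /ℕ D) * + D) ⟩
    + (a %ℕ D)                                     ∎
    where
    open ≡-Reasoning
    cancel : ∀ u v → u + v - v ≡ u
    cancel = solve-∀

  %ℕ≡0⇒∣ : ∀ a → a %ℕ D ≡ 0 → + D Signed.∣ a
  %ℕ≡0⇒∣ a a%D≡0 = Signed.divides (a /ℕ D)
    (trans (a≡a%ℕn+[a/ℕn]*n a D) (trans (cong (λ r → + r + (a /ℕ D) * + D) a%D≡0) (ℤP.+-identityˡ _)))

  reduce : ∀ p → Σ Point λ p′ → σ p′ ≡ + (σ p %ℕ D) × τ p′ ≡ + (τ p %ℕ D)
  reduce p = translate (σ p /ℕ D) (τ p /ℕ D) p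
           , trans (σ-translate (σ p /ℕ D) (τ p /ℕ D) p) (minus-quotient (σ p))
           , trans (τ-translate (σ p /ℕ D) (τ p /ℕ D) p) (minus-quotient (τ p))

  complement : ∀ {a s} → a ≡ + s → s ℕ.≤ D → cross x y z - a ≡ + (D ℕ.∸ s)
  complement {s = s} a≡s s≤D =
    trans (cong₂ _-_ cross≡D a≡s) (trans (ℤP.m-n≡m⊖n D s) (ℤP.⊖-≥ s≤D))

  nonvertex-below-diagonal : ∀ p s t → σ p ≡ + s → τ p ≡ + t → s ℕ.< D → t ℕ.< D →
    0 ℕ.< s ℕ.+ t → s ℕ.+ t ℕ.≤ D → NonVertexPoint x y z
  nonvertex-below-diagonal p s t σp≡s τp≡t s<D t<D 0<s+t s+t≤D =
    nonvertex-of-weights p (D ℕ.∸ (s ℕ.+ t)) s t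
      (trans (ℕP.+-assoc (D ℕ.∸ (s ℕ.+ t)) s t) (ℕP.m∸n+n≡m s+t≤D))
      (ℕP.∸-monoʳ-< 0<s+t s+t≤D) s<D t<D σp≡s τp≡t

  nonvertex-of-residues : ∀ p s t → σ p ≡ + s → τ p ≡ + t → s ℕ.< D → t ℕ.< D →
    0 ℕ.< s ℕ.+ t → NonVertexPoint x y z
  nonvertex-of-residues p s t σp≡s τp≡t s<D t<D 0<s+t with s ℕ.+ t ℕ.≤? D
  ... | yes s+t≤D = nonvertex-below-diagonal p s t σp≡s τp≡t s<D t<D 0<s+t s+t≤D
  ... | no s+t≰D =
    let D∸s<D , D∸t<D , 0<sum , sum≤D = reflected-residues s<D t<D (ℕP.≰⇒> s+t≰D) in
    nonvertex-below-diagonal (reflect p) (D ℕ.∸ s) (D ℕ.∸ t)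
      (trans (σ-reflect p) (complement σp≡s (ℕP.<⇒≤ s<D)))
      (trans (τ-reflect p) (complement τp≡t (ℕP.<⇒≤ t<D)))
      D∸s<D D∸t<D 0<sum sum≤D

  Residual : Point → Set
  Residual p = 0 ℕ.< σ p %ℕ D ℕ.+ τ p %ℕ D

  residual-or-divisible : ∀ p → Residual p ⊎ (+ D Signed.∣ σ p × + D Signed.∣ τ p)
  residual-or-divisible p with σ p %ℕ D in σ≡ | τ p %ℕ D in τ≡
  ... | suc _ | _     = inj₁ ℕ.z<s
  ... | zero  | suc _ = inj₁ ℕ.z<s
  ... | zero  | zero  = inj₂ (%ℕ≡0⇒∣ (σ p) σ≡ , %ℕ≡0⇒∣ (τ p) τ≡)

  nonvertex-of-residual : ∀ p → Residual p → NonVertexPoint x y z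
  nonvertex-of-residual p residual =
    let p′ , σp′≡ , τp′≡ = reduce p in
    nonvertex-of-residues p′ _ _ σp′≡ τp′≡ (n%ℕd<d (σ p) D) (n%ℕd<d (τ p) D) residual

  D∣1 : + D Signed.∣ σ e₁ → + D Signed.∣ τ e₁ → + D Signed.∣ σ e₂ → + D Signed.∣ τ e₂ → D ≡ 1
  D∣1 σ₁ τ₁ σ₂ τ₂ = ℕ∣.∣1⇒≡1 (Signed.∣⇒∣ᵤ (Signed.*-cancelˡ-∣ (+ D) D*D∣D*1))
    where
    D*D∣D*1 : + D * + D Signed.∣ + D * 1ℤ
    D*D∣D*1 = subst (+ D * + D Signed.∣_)
      (trans (sym cross-unit-determinant) (trans cross≡D (sym (ℤP.*-identityʳ (+ D)))))
      (Signed.∣m∣n⇒∣m-n (∣-*-∣ σ₁ τ₂) (∣-*-∣ σ₂ τ₁))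

  nonvertex-point : D ≢ 1 → NonVertexPoint x y z
  nonvertex-point D≢1 with residual-or-divisible e₁ | residual-or-divisible e₂
  ... | inj₁ residual | _             = nonvertex-of-residual e₁ residual
  ... | inj₂ _        | inj₁ residual = nonvertex-of-residual e₂ residual
  ... | inj₂ (σ₁ , τ₁) | inj₂ (σ₂ , τ₂) = contradiction (D∣1 σ₁ τ₁ σ₂ τ₂) D≢1

IsUnit : ℤ → Set
IsUnit X = X ≡ 1ℤ ⊎ X ≡ -1ℤ

Empty⇒cross-unit-or-0 : ∀ x y z → Empty x y z → cross x y z ≡ 0ℤ ⊎ IsUnit (cross x y z)
Empty⇒cross-unit-or-0 x y z empty with cross x y z in cross≡
... | + 0 = inj₁ refl
... | + 1 = inj₂ (inj₁ refl)
... | -[1+ 0 ] = inj₂ (inj₂ refl)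
... | + suc (suc d) =
  ⊥-elim (Empty⇒¬NonVertexPoint empty (NonUnimodular.nonvertex-point x y z (2 ℕ.+ d) cross≡ λ ()))
... | -[1+ suc d ] =
  ⊥-elim (Empty⇒¬NonVertexPoint (Empty-swap x y z empty)
    (NonUnimodular.nonvertex-point x z y (2 ℕ.+ d) (trans (cross-swap x y z) (cong -_ cross≡)) λ ()))

-- Internal triangles

Corner : Point → Point → Point → Point → Point → Set
Corner a b c q p = p ≡ a ⊎ p ≡ b ⊎ p ≡ c ⊎ p ≡ q

Corner⇒∈ : ∀ {a b c q p} → Corner a b c q p → p ∈ a ∷ b ∷ c ∷ q ∷ []
Corner⇒∈ (inj₁ p≡a)               = here p≡a
Corner⇒∈ (inj₂ (inj₁ p≡b))        = there (here p≡b)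
Corner⇒∈ (inj₂ (inj₂ (inj₁ p≡c))) = there (there (here p≡c))
Corner⇒∈ (inj₂ (inj₂ (inj₂ p≡q))) = there (there (there (here p≡q)))

-- InternalTriangle with its interior point q as a parameter, so that it can be rotated.
IsInternalWith : Point → Point → Point → Point → Set
IsInternalWith a b c q = NonCollinear a b c × InInterior a b c q × (∀ p → InHull a b c p → Corner a b c q p)

IsInternalWith-rotate : ∀ a b c q → IsInternalWith a b c q → IsInternalWith b c a q
IsInternalWith-rotate a b c q (noncollinear , (l , m , k , interior) , corners) =
    noncollinear ∘ trans (cross-rotate a b c)
  , (m , k , l , IsConvComb-rotate a b c q (suc l) (suc m) (suc k) interior)
  , λ p hull → rotate-corner (corners p (InHull-rotate c a b p (InHull-rotate b c a p hull)))
  where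
  rotate-corner : ∀ {p} → Corner a b c q p → Corner b c a q p
  rotate-corner (inj₁ p≡a)               = inj₂ (inj₂ (inj₁ p≡a))
  rotate-corner (inj₂ (inj₁ p≡b))        = inj₁ p≡b
  rotate-corner (inj₂ (inj₂ (inj₁ p≡c))) = inj₂ (inj₁ p≡c)
  rotate-corner (inj₂ (inj₂ (inj₂ p≡q))) = inj₂ (inj₂ (inj₂ p≡q))

-- Reading off cross a b _, c ∈ abq and q ∈ abc give T·S = z·(k+1), impossible as z ≤ T and k+1 < S.
vertex∉subtriangle : ∀ a b c q l m k → NonCollinear a b c → IsConvComb a b c q (suc l) (suc m) (suc k) →
  ¬ InHull a b q c
vertex∉subtriangle a b c q l m k noncollinear interior (x , y , z , T≢0 , c∈abq) =
  ℕP.<-irrefl (sym ST≡zK)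
    (ℕP.≤-<-trans (ℕP.*-monoˡ-≤ (suc k) z≤T) (ℕP.*-monoʳ-< T {{ℕ.≢-nonZero T≢0}} K<S))
  where
  T : ℕ
  T = x ℕ.+ y ℕ.+ z
  S : ℕ
  S = suc l ℕ.+ suc m ℕ.+ suc k
  z≤T : z ℕ.≤ T
  z≤T = ℕP.m≤n+m z (x ℕ.+ y)
  K<S : suc k ℕ.< S
  K<S = ℕP.m<n+m (suc k) ℕ.z<s
  D : ℤ
  D = cross a b c
  X : ℤ
  X = cross a b q
  open ≡-Reasoning
  ST≡zK : T ℕ.* S ≡ z ℕ.* suc k
  ST≡zK = ℤP.+-injective (ℤP.*-cancelʳ-≡ (+ (T ℕ.* S)) (+ (z ℕ.* suc k)) D {{ℤ.≢-nonZero noncollinear}} (begin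
    + (T ℕ.* S) * D       ≡⟨ cong (_* D) (pos-* T S) ⟩
    + T * + S * D         ≡⟨ reassociate (+ T) (+ S) D ⟩
    + S * (+ T * D)       ≡⟨ cong (+ S *_) (IsConvComb⇒cross a b q c x y z c∈abq) ⟩
    + S * (+ z * X)       ≡⟨ exchange (+ S) (+ z) X ⟩
    + z * (+ S * X)       ≡⟨ cong (+ z *_) (IsConvComb⇒cross a b c q (suc l) (suc m) (suc k) interior) ⟩
    + z * (+ suc k * D)   ≡⟨ ℤP.*-assoc (+ z) (+ suc k) D ⟨
    + z * + suc k * D     ≡⟨ cong (_* D) (pos-* z (suc k)) ⟨
    + (z ℕ.* suc k) * D   ∎))
    where reassociate : ∀ u v w → u * v * w ≡ v * (u * w)
          reassociate = solve-∀
          exchange : ∀ u v w → u * (v * w) ≡ v * (u * w)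
          exchange = solve-∀

subtriangle-empty : ∀ a b c q → IsInternalWith a b c q → Empty a b q
subtriangle-empty a b c q (noncollinear , (l , m , k , interior) , corners) p p∈abq@(x , y , z , T≢0 , h) =
  sort (corners p
    ( x ℕ.* S ℕ.+ z ℕ.* suc l , y ℕ.* S ℕ.+ z ℕ.* suc m , z ℕ.* suc k , W≢0
    , IsConvComb-compose a b c q p x y z (suc l) (suc m) (suc k) h interior))
  where
  S : ℕ
  S = suc l ℕ.+ suc m ℕ.+ suc k
  W≢0 : x ℕ.* S ℕ.+ z ℕ.* suc l ℕ.+ (y ℕ.* S ℕ.+ z ℕ.* suc m) ℕ.+ z ℕ.* suc k ≢ 0
  W≢0 W≡0 = [ T≢0 , (λ ()) ]
    (ℕP.m*n≡0⇒m≡0∨n≡0 (x ℕ.+ y ℕ.+ z) (trans (sym (composed-weights-sum x y z (suc l) (suc m) (suc k))) W≡0))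
  sort : Corner a b c q p → p ≡ a ⊎ p ≡ b ⊎ p ≡ q
  sort (inj₁ p≡a)               = inj₁ p≡a
  sort (inj₂ (inj₁ p≡b))        = inj₂ (inj₁ p≡b)
  sort (inj₂ (inj₂ (inj₁ p≡c))) =
    ⊥-elim (vertex∉subtriangle a b c q l m k noncollinear interior (subst (InHull a b q) p≡c p∈abq))
  sort (inj₂ (inj₂ (inj₂ p≡q))) = inj₂ (inj₂ p≡q)

subtriangle-unit : ∀ a b c q → IsInternalWith a b c q → IsUnit (cross a b q)
subtriangle-unit a b c q internal@(noncollinear , (l , m , k , interior) , _) =
  [ (λ X≡0 → contradiction X≡0 X≢0) , id ]
    (Empty⇒cross-unit-or-0 a b q (subtriangle-empty a b c q internal))
  where
  X≢0 : cross a b q ≢ 0ℤ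
  X≢0 X≡0 = [ (λ ()) , noncollinear ] (ℤP.i*j≡0⇒i≡0∨j≡0 (+ suc k)
    (trans (sym (IsConvComb⇒cross a b c q (suc l) (suc m) (suc k) interior))
           (trans (cong (+ (suc l ℕ.+ suc m ℕ.+ suc k) *_) X≡0) (ℤP.*-zeroʳ (+ (suc l ℕ.+ suc m ℕ.+ suc k))))))

IsUnit⇒∣3 : ∀ {X} → IsUnit X → ∣ X ∣ ℕ∣.∣ 3
IsUnit⇒∣3 (inj₁ refl) = ℕ∣.1∣ 3
IsUnit⇒∣3 (inj₂ refl) = ℕ∣.1∣ 3

IsUnit-sum∣3 : ∀ {X Y Z} → IsUnit X → IsUnit Y → IsUnit Z → ∣ X + Y + Z ∣ ℕ∣.∣ 3
IsUnit-sum∣3 (inj₁ refl) (inj₁ refl) (inj₁ refl) = ℕ∣.∣-refl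
IsUnit-sum∣3 (inj₁ refl) (inj₁ refl) (inj₂ refl) = ℕ∣.1∣ 3
IsUnit-sum∣3 (inj₁ refl) (inj₂ refl) (inj₁ refl) = ℕ∣.1∣ 3
IsUnit-sum∣3 (inj₁ refl) (inj₂ refl) (inj₂ refl) = ℕ∣.1∣ 3
IsUnit-sum∣3 (inj₂ refl) (inj₁ refl) (inj₁ refl) = ℕ∣.1∣ 3
IsUnit-sum∣3 (inj₂ refl) (inj₁ refl) (inj₂ refl) = ℕ∣.1∣ 3
IsUnit-sum∣3 (inj₂ refl) (inj₂ refl) (inj₁ refl) = ℕ∣.1∣ 3
IsUnit-sum∣3 (inj₂ refl) (inj₂ refl) (inj₂ refl) = ℕ∣.∣-refl

corner-triples-∣3 : ∀ a b c q → IsInternalWith a b c q →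
  ∣ cross a b c ∣ ℕ∣.∣ 3 × ∣ cross a b q ∣ ℕ∣.∣ 3 ×
  ∣ cross b c q ∣ ℕ∣.∣ 3 × ∣ cross c a q ∣ ℕ∣.∣ 3
corner-triples-∣3 a b c q internal =
    subst (λ D → ∣ D ∣ ℕ∣.∣ 3) (sym (cross-split a b c q)) (IsUnit-sum∣3 abq bcq caq)
  , IsUnit⇒∣3 abq , IsUnit⇒∣3 bcq , IsUnit⇒∣3 caq
  where
  internal′ : IsInternalWith b c a q
  internal′ = IsInternalWith-rotate a b c q internal
  abq : IsUnit (cross a b q)
  abq = subtriangle-unit a b c q internal
  bcq : IsUnit (cross b c q)
  bcq = subtriangle-unit b c a q internal′
  caq : IsUnit (cross c a q)
  caq = subtriangle-unit c a b q (IsInternalWith-rotate b c a q internal′)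

InI⇒∣cross : ∀ n u v w → InI n u → InI n v → InI n w → n ℕ∣.∣ ∣ cross u v w ∣
InI⇒∣cross n u v w u∈I v∈I w∈I = Signed.∣⇒∣ᵤ (Signed.∣m∣n⇒∣m-n
    (Signed.∣n⇒∣m*n (xc v - xc u) (∣-height-difference w w∈I))
    (Signed.∣m⇒∣m*n (xc w - xc u) (∣-height-difference v v∈I)))
  where
  ∣-height-difference : ∀ p → InI n p → + n Signed.∣ yc p - yc u
  ∣-height-difference p p∈I =
    Signed.∣m∣n⇒∣m-n (Signed.∣ᵤ⇒∣ {i = yc p} p∈I) (Signed.∣ᵤ⇒∣ {i = yc u} u∈I)

¬InI³ : ∀ {n} u v w → n ≢ 1 → n ≢ 3 → ∣ cross u v w ∣ ℕ∣.∣ 3 → ¬ (InI n u × InI n v × InI n w)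
¬InI³ {n} u v w n≢1 n≢3 ∣cross∣∣3 (u∈I , v∈I , w∈I) =
  [ n≢1 , n≢3 ] (prime⇒irreducible (toWitness {a? = prime? 3} _)
                  (ℕ∣.∣-trans (InI⇒∣cross n u v w u∈I v∈I w∈I) ∣cross∣∣3))

InI? : ∀ n → Decidable (InI n)
InI? n p = n ℕ∣.∣? ∣ yc p ∣

no-three-corners-in-I : ∀ {n} a b c q → n ≢ 1 → n ≢ 3 → IsInternalWith a b c q →
  ¬ (InI n a × InI n b × InI n c) × ¬ (InI n a × InI n b × InI n q) ×
  ¬ (InI n b × InI n c × InI n q) × ¬ (InI n c × InI n a × InI n q)
no-three-corners-in-I a b c q n≢1 n≢3 internal =
  let abc , abq , bcq , caq = corner-triples-∣3 a b c q internal in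
  ¬InI³ a b c n≢1 n≢3 abc , ¬InI³ a b q n≢1 n≢3 abq , ¬InI³ b c q n≢1 n≢3 bcq , ¬InI³ c a q n≢1 n≢3 caq

lemma4p2 : (n : ℕ) → 1 ℕ.≤ n → ¬ (n ≡ 1) → ¬ (n ≡ 3) →
    (a b c : Point) → InternalTriangle a b c →
    (ps : List Point) → Unique ps → All (λ p → InHull a b c p × InI n p) ps →
    length ps ℕ.≤ 2
lemma4p2 n _ n≢1 n≢3 a b c (noncollinear , q , interior , corners) ps unique ps⊆hull∩I = begin
  length ps
    ≤⟨ Unique-⊆⇒length≤ unique ps⊆corners∩I ⟩
  length (filter (InI? n) (a ∷ b ∷ c ∷ q ∷ []))
    ≤⟨ length-filter≤2 (InI? n) (no-three-corners-in-I a b c q n≢1 n≢3 (noncollinear , interior , corners)) ⟩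
  2 ∎
  where
  open ℕP.≤-Reasoning
  ps⊆corners∩I : ps ⊆ filter (InI? n) (a ∷ b ∷ c ∷ q ∷ [])
  ps⊆corners∩I p∈ps =
    let p∈hull , p∈I = All.lookup ps⊆hull∩I p∈ps in
    ∈-filter⁺ (InI? n) (Corner⇒∈ (corners _ p∈hull)) p∈I
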